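{- Let $A,B$ be sets of nonnegative integers with $|A|,|B|\ge2$ and let $\underline{\alpha}=(\alpha_1,\dots,\alpha_s)$, $\underline{\beta}=(\beta_1,\dots,\beta_t)\in\mathbb{Z}^+_m$. Then (i) $\underline{\alpha}A=\underline{\alpha}B$ if and only if $A=B$; (ii) $\underline{\alpha}A=\underline{\beta}A$ if and only if $\underline{\alpha}=\underline{\beta}$.
   Context: $\mathbb{Z}^+_m$ is the set of finite vectors $(\alpha_1,\dots,\alpha_s)$ ($s\ge1$ arbitrary) of positive integers with $\alpha_1\le\cdots\le\alpha_s$. For a set $A=\{a_1<a_2<\cdots\}$ of nonnegative integers, $\underline{\alpha}A=\alpha_1A+\cdots+\alpha_sA$ is the multiset in which $n$ has multiplicity $R_{A,\underline{\alpha}}(n)=|\{(j_1,\dots,j_s)\in(\mathbb{Z}^+)^s:\sum_i\alpha_ia_{j_i}=n\}|$; so $\underline{\alpha}A=\underline{\beta}B$ means $R_{A,\underline{\alpha}}(n)=R_{B,\underline{\beta}}(n)$ for all $n\ge0$. -}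

module Defs where

open import Data.Nat using (ℕ; zero; suc; _+_; _*_; _≤_; _<_; _≡ᵇ_)
open import Data.Bool using (Bool; true; false; _∧_; if_then_else_)
open import Data.List using (List; []; _∷_; [_]; map; concatMap; upTo; length)
open import Data.Nat.ListAction using (sum)
open import Data.Bool.ListAction using (all)
open import Data.List.Relation.Unary.All using (All)
open import Data.List.Relation.Unary.Linked using (Linked)
open import Data.Product using (_×_; ∃-syntax)
open import Relation.Binary.PropositionalEquality using (_≡_; _≢_)

NatSet : Set
NatSet = ℕ → Bool

AtLeastTwo : NatSet → Set
AtLeastTwo A = ∃[ a ] ∃[ b ] (a ≢ b × A a ≡ true × A b ≡ true)

IsZm : List ℕ → Set
IsZm α = 1 ≤ length α × All (λ a → 1 ≤ a) α × Linked _≤_ α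

tuples : ℕ → ℕ → List (List ℕ)
tuples zero    n = [ [] ]
tuples (suc s) n = concatMap (λ x → map (x ∷_) (tuples s n)) (upTo (suc n))

weighted : List ℕ → List ℕ → ℕ
weighted (a ∷ as) (x ∷ xs) = a * x + weighted as xs
weighted _        _        = 0

-- R_{A,α}(n) = #{(x_1,…,x_s) ∈ A^s : Σ α_i x_i = n}.
-- Since every α_i ≥ 1, every such tuple has all x_i ≤ n, so it suffices
-- to enumerate tuples with entries in {0,…,n}.
R : NatSet → List ℕ → ℕ → ℕ
R A α n = sum (map (λ xs → if all A xs ∧ (weighted α xs ≡ᵇ n) then 1 else 0)
                   (tuples (length α) n))

-- multiset equality αA = βB
SumsetEq : List ℕ → NatSet → List ℕ → NatSet → Set
SumsetEq α A β B = ∀ n → R A α n ≡ R B β n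

SetEq : NatSet → NatSet → Set
SetEq A B = ∀ n → A n ≡ B n

-- Write R_{A,γ} as an iterated convolution: one factor per weight g, summing over x ∈ A with g x ≤ n.
--
-- (i) If A ≠ B, let k be the least point where they differ, say k ∈ A ∖ B, let m = min A and
-- N = α₁ k + m (α₂ + ⋯ + α_s). A representation of N cannot use an element beyond k, so B
-- represents N as often as B ∩ [0, k] ⊆ A does, which misses the representation (k, m, …, m).
--
-- (ii) Let m < m + d be the two least elements of A. The two smallest numbers represented with
-- weights γ are m Σγ and m Σγ + γ₁ d, so αA = βA forces α₁ = β₁. Since A has a least element,
-- the common first factor cancels from the convolution and induction on the length finishes.
module Submission where

open import Data.Bool using (true; false; _∧_; if_then_else_)
open import Data.Bool.ListAction using (all)
open import Data.Bool.Properties using (∧-zeroʳ) renaming (_≟_ to _≟ᵇ_)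
open import Data.Empty using (⊥; ⊥-elim)
open import Data.List using (List; []; _∷_; _++_; map; concatMap; upTo; applyUpTo; length)
open import Data.List.Properties using (map-++; map-cong; map-∘)
open import Data.List.Relation.Unary.All using (All; []; _∷_)
open import Data.List.Relation.Unary.Linked using (Linked; [-]; _∷_)
import Data.List.Relation.Unary.Linked as Linked
open import Data.List.Relation.Unary.Linked.Properties using (Linked⇒All)
open import Data.Nat
open import Data.Nat.Properties
open import Data.Nat.Induction using (<-rec)
open import Data.Nat.ListAction using (sum)
open import Data.Nat.ListAction.Properties using (sum-++)
open import Data.Nat.Tactic.RingSolver using (solve-∀)
open import Data.Product using (_×_; _,_; ∃-syntax)
open import Data.Sum using (_⊎_; inj₁; inj₂; [_,_]′)
open import Function using (_∘_; id)
open import Function.Bundles using (_⇔_; mk⇔; Equivalence)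
open import Relation.Binary.PropositionalEquality
open import Relation.Nullary using (¬_; yes; no)
open import Relation.Nullary.Reflects using (ofʸ; ofⁿ)

open import Defs

infix 4 _∈_ _∉_ _⊆_

_∈_ : ℕ → NatSet → Set
x ∈ A = A x ≡ true

_∉_ : ℕ → NatSet → Set
x ∉ A = A x ≡ false

_⊆_ : NatSet → NatSet → Set
A ⊆ B = ∀ {x} → x ∈ A → x ∈ B

LowerBound : NatSet → ℕ → Set
LowerBound A m = ∀ {x} → x ∈ A → m ≤ x

IsLeast : NatSet → ℕ → Set
IsLeast A m = m ∈ A × LowerBound A m

HasGap : NatSet → ℕ → ℕ → Set
HasGap A m d = ∀ {x} → x ∈ A → x ≡ m ⊎ m + d ≤ x

∈⇒¬∉ : ∀ {A x} → x ∈ A → ¬ x ∉ A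
∈⇒¬∉ x∈A x∉A with trans (sym x∈A) x∉A
... | ()

HasGap⇒LowerBound : ∀ {A m d} → HasGap A m d → LowerBound A m
HasGap⇒LowerBound {m = m} gap x∈A = [ ≤-reflexive ∘ sym , m+n≤o⇒m≤o m ]′ (gap x∈A)

_∩<_ : NatSet → ℕ → NatSet
(A ∩< b) x = (x <ᵇ b) ∧ A x

_∩>_ : NatSet → ℕ → NatSet
(A ∩> a) x = (a <ᵇ x) ∧ A x

∈-∩< : ∀ {A b x} → x ∈ A ∩< b → x < b × x ∈ A
∈-∩< {A} {b} {x} x∈ with x <ᵇ b | <ᵇ-reflects-< x b
... | true  | ofʸ x<b = x<b , x∈
∈-∩< {A} {b} {x} () | false | _

∩<-below : ∀ {A b x} → x < b → (A ∩< b) x ≡ A x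
∩<-below {A} {b} {x} x<b with x <ᵇ b | <ᵇ-reflects-< x b
... | true  | _        = refl
... | false | ofⁿ x≮b = ⊥-elim (x≮b x<b)

∩<-above : ∀ {A b x} → ¬ x < b → x ∉ A ∩< b
∩<-above {A} {b} {x} x≮b with x <ᵇ b | <ᵇ-reflects-< x b
... | true  | ofʸ x<b = ⊥-elim (x≮b x<b)
... | false | _        = refl

∉-∩< : ∀ {A b x} → x ∉ A → x ∉ A ∩< b
∉-∩< {b = b} {x} x∉A = trans (cong ((x <ᵇ b) ∧_) x∉A) (∧-zeroʳ (x <ᵇ b))

∈-∩> : ∀ {A a x} → x ∈ A ∩> a → a < x × x ∈ A
∈-∩> {A} {a} {x} x∈ with a <ᵇ x | <ᵇ-reflects-< a x
... | true  | ofʸ a<x = a<x , x∈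
∈-∩> {A} {a} {x} () | false | _

∈-∩>⁺ : ∀ {A a x} → a < x → x ∈ A → x ∈ A ∩> a
∈-∩>⁺ {A} {a} {x} a<x x∈A with a <ᵇ x | <ᵇ-reflects-< a x
... | true  | _        = x∈A
... | false | ofⁿ a≮x = ⊥-elim (a≮x a<x)

least : ∀ A {k} → k ∈ A → ∃[ m ] IsLeast A m
least A {k} = <-rec (λ n → n ∈ A → ∃[ m ] IsLeast A m) step k
  where
  step : ∀ n → (∀ {j} → j < n → j ∈ A → ∃[ m ] IsLeast A m) → n ∈ A → ∃[ m ] IsLeast A m
  step n rec n∈A with anyUpTo? (λ x → A x ≟ᵇ true) n
  ... | yes (j , j<n , j∈A) = rec j<n j∈A
  ... | no none             = n , n∈A , λ {x} x∈A → ≮⇒≥ (λ x<n → none (x , x<n , x∈A))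

nonLeast : ∀ {A m} → AtLeastTwo A → ∃[ w ] (w ∈ A × m ≢ w)
nonLeast {m = m} (u , v , u≢v , u∈A , v∈A) with m ≟ u
... | no m≢u   = u , u∈A , m≢u
... | yes refl = v , v∈A , u≢v

leastTwo : ∀ {A} → AtLeastTwo A → ∃[ m ] ∃[ d ] (0 < d × m ∈ A × m + d ∈ A × HasGap A m d)
leastTwo {A} two@(_ , _ , _ , u∈A , _) with least A u∈A
... | m , m∈A , m≤ with nonLeast {m = m} two
... | w , w∈A , m≢w with least (A ∩> m) (∈-∩>⁺ {A} (≤∧≢⇒< (m≤ w∈A) m≢w) w∈A)
... | m′ , m′∈ , m′≤ with ∈-∩> {A} m′∈
... | m<m′ , m′∈A = m , m′ ∸ m , m<n⇒0<n∸m m<m′ , m∈A , subst (_∈ A) (sym m+d≡m′) m′∈A , gap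
  where
  m+d≡m′ : m + (m′ ∸ m) ≡ m′
  m+d≡m′ = m+[n∸m]≡n (<⇒≤ m<m′)
  gap : HasGap A m (m′ ∸ m)
  gap {x} x∈A with m ≟ x
  ... | yes m≡x = inj₁ (sym m≡x)
  ... | no m≢x  = inj₂ (subst (_≤ x) (sym m+d≡m′) (m′≤ (∈-∩>⁺ {A} (≤∧≢⇒< (m≤ x∈A) m≢x) x∈A)))

sumBelow : ℕ → (ℕ → ℕ) → ℕ
sumBelow zero    F = 0
sumBelow (suc b) F = F 0 + sumBelow b (F ∘ suc)

sum-map-applyUpTo : ∀ (F f : ℕ → ℕ) b → sum (map F (applyUpTo f b)) ≡ sumBelow b (F ∘ f)
sum-map-applyUpTo F f zero    = refl
sum-map-applyUpTo F f (suc b) = cong (F (f 0) +_) (sum-map-applyUpTo F (f ∘ suc) b)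

sumBelow-cong : ∀ b (F G : ℕ → ℕ) → (∀ {x} → x < b → F x ≡ G x) → sumBelow b F ≡ sumBelow b G
sumBelow-cong zero    F G F≡G = refl
sumBelow-cong (suc b) F G F≡G = cong₂ _+_ (F≡G z<s) (sumBelow-cong b (F ∘ suc) (G ∘ suc) (F≡G ∘ s<s))

sumBelow-mono-≤ : ∀ b (F G : ℕ → ℕ) → (∀ {x} → x < b → F x ≤ G x) → sumBelow b F ≤ sumBelow b G
sumBelow-mono-≤ zero    F G F≤G = z≤n
sumBelow-mono-≤ (suc b) F G F≤G = +-mono-≤ (F≤G z<s) (sumBelow-mono-≤ b (F ∘ suc) (G ∘ suc) (F≤G ∘ s<s))

sumBelow-mono-< : ∀ {b} (F G : ℕ → ℕ) {x} → x < b → F x < G x →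
                  (∀ {y} → y < b → F y ≤ G y) → sumBelow b F < sumBelow b G
sumBelow-mono-< {suc b} F G {zero}  _         Fx<Gx F≤G =
  +-mono-<-≤ Fx<Gx (sumBelow-mono-≤ b (F ∘ suc) (G ∘ suc) (F≤G ∘ s<s))
sumBelow-mono-< {suc b} F G {suc x} (s<s x<b) Fx<Gx F≤G =
  +-mono-≤-< (F≤G z<s) (sumBelow-mono-< (F ∘ suc) (G ∘ suc) x<b Fx<Gx (F≤G ∘ s<s))

≤-sumBelow : ∀ {b} F {x} → x < b → F x ≤ sumBelow b F
≤-sumBelow {suc b} F {zero}  _         = m≤m+n (F 0) _
≤-sumBelow {suc b} F {suc x} (s<s x<b) = ≤-trans (≤-sumBelow (F ∘ suc) x<b) (m≤n+m _ (F 0))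

sumBelow-pos : ∀ b F → 0 < sumBelow b F → ∃[ x ] (x < b × 0 < F x)
sumBelow-pos (suc b) F pos with F 0 in F0≡
... | suc _ = 0 , z<s , subst (0 <_) (sym F0≡) z<s
... | zero with sumBelow-pos b (F ∘ suc) pos
... | x , x<b , Fx>0 = suc x , s<s x<b , Fx>0

sumBelow-extend : ∀ {b c} F → b ≤ c → (∀ {x} → b ≤ x → F x ≡ 0) → sumBelow c F ≡ sumBelow b F
sumBelow-extend {zero}  {zero}  F _         _      = refl
sumBelow-extend {zero}  {suc c} F _         vanish =
  cong₂ _+_ (vanish z≤n) (sumBelow-extend {c = c} (F ∘ suc) z≤n (λ _ → vanish z≤n))
sumBelow-extend {suc b} {suc c} F (s≤s b≤c) vanish =
  cong (F 0 +_) (sumBelow-extend (F ∘ suc) b≤c (vanish ∘ s≤s))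

sumBelow-cancel : ∀ {b} (F G : ℕ → ℕ) {x} → x < b → (∀ {y} → y < b → y ≢ x → F y ≡ G y) →
                  sumBelow b F ≡ sumBelow b G → F x ≡ G x
sumBelow-cancel {suc b} F G {zero} _ others sums =
  +-cancelʳ-≡ _ (F 0) (G 0)
    (trans sums (cong (G 0 +_) (sym (sumBelow-cong b (F ∘ suc) (G ∘ suc) (λ y<b → others (s<s y<b) λ ())))))
sumBelow-cancel {suc b} F G {suc x} (s<s x<b) others sums =
  sumBelow-cancel (F ∘ suc) (G ∘ suc) x<b (λ y<b y≢x → others (s<s y<b) (y≢x ∘ suc-injective))
    (+-cancelˡ-≡ (F 0) _ _ (trans sums (cong (_+ sumBelow b (G ∘ suc)) (sym (others z<s λ ())))))

m≤n*m+o : ∀ m {n} o → 0 < n → m ≤ n * m + o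
m≤n*m+o m {n} o n>0 = ≤-trans (m≤n*m m n {{>-nonZero n>0}}) (m≤m+n (n * m) o)

-- Opaque, so that unification never unfolds summand A g f n x and its arguments stay inferable.
opaque
  summand : NatSet → ℕ → (ℕ → ℕ) → ℕ → ℕ → ℕ
  summand A g f n x = if A x ∧ (g * x ≤ᵇ n) then f (n ∸ g * x) else 0

  summand-elim : ∀ {A g f n x} (P : ℕ → Set) → P 0 →
                 (∀ {r} → x ∈ A → n ≡ g * x + r → P (f r)) → P (summand A g f n x)
  summand-elim {A} {g} {f} {n} {x} P p0 pf with A x | g * x ≤ᵇ n | ≤ᵇ-reflects-≤ (g * x) n
  ... | false | _     | _         = p0
  ... | true  | false | _         = p0
  ... | true  | true  | ofʸ gx≤n  = pf refl (sym (m+[n∸m]≡n gx≤n))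

  summand-absent : ∀ {A g f n x} → x ∉ A → summand A g f n x ≡ 0
  summand-absent x∉A rewrite x∉A = refl

  summand-hit : ∀ {A} g f {x} r → x ∈ A → summand A g f (g * x + r) x ≡ f r
  summand-hit g f {x} r x∈A rewrite x∈A with g * x ≤ᵇ g * x + r | ≤ᵇ-reflects-≤ (g * x) (g * x + r)
  ... | true  | _         = cong f (m+n∸m≡n (g * x) r)
  ... | false | ofⁿ gx≰n  = ⊥-elim (gx≰n (m≤m+n (g * x) r))

  summand-cong : ∀ {A g f h n x} → (∀ {r} → x ∈ A → n ≡ g * x + r → f r ≡ h r) →
                 summand A g f n x ≡ summand A g h n x
  summand-cong {A} {g} {f} {h} {n} {x} f≡h with A x | g * x ≤ᵇ n | ≤ᵇ-reflects-≤ (g * x) n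
  ... | false | _     | _        = refl
  ... | true  | false | _        = refl
  ... | true  | true  | ofʸ gx≤n = f≡h refl (sym (m+[n∸m]≡n gx≤n))

  summand-congˡ : ∀ {A B g f n x} → A x ≡ B x → summand A g f n x ≡ summand B g f n x
  summand-congˡ {g = g} {f} {n} {x} Ax≡Bx =
    cong (λ c → if c ∧ (g * x ≤ᵇ n) then f (n ∸ g * x) else 0) Ax≡Bx

  summand-mono : ∀ {A B g f h n x} → A ⊆ B → (∀ r → f r ≤ h r) → summand A g f n x ≤ summand B g h n x
  summand-mono {A} {B} {g} {f} {h} {n} {x} A⊆B f≤h with A x in x∈A
  ... | false = z≤n
  ... | true rewrite A⊆B x∈A with g * x ≤ᵇ n
  ... | true  = f≤h (n ∸ g * x)
  ... | false = z≤n

summand-pos : ∀ {A g f n x} → 0 < summand A g f n x → ∃[ r ] (x ∈ A × n ≡ g * x + r × 0 < f r)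
summand-pos {A} {g} {f} {n} {x} =
  summand-elim (λ s → 0 < s → ∃[ r ] (x ∈ A × n ≡ g * x + r × 0 < f r))
    (λ ()) (λ x∈A n≡ fr>0 → _ , x∈A , n≡ , fr>0)

summand-vanish : ∀ {A g f n x} → (∀ {r} → x ∈ A → n ≡ g * x + r → f r ≡ 0) → summand A g f n x ≡ 0
summand-vanish = summand-elim (_≡ 0) refl

summand-over : ∀ {A g f n x} → n < g * x → summand A g f n x ≡ 0
summand-over {g = g} {x = x} n<gx =
  summand-vanish λ {r} _ n≡ → ⊥-elim (<⇒≱ n<gx (subst (g * x ≤_) (sym n≡) (m≤m+n (g * x) r)))

-- Only meaningful for g ≥ 1, when x ≤ n already covers every x with g * x ≤ n.
convolve : NatSet → ℕ → (ℕ → ℕ) → ℕ → ℕ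
convolve A g f n = sumBelow (suc n) (summand A g f n)

convolve-hit : ∀ {A g} f {x} r → 0 < g → x ∈ A → f r ≤ convolve A g f (g * x + r)
convolve-hit {A} {g} f {x} r g>0 x∈A = begin
  f r                          ≡⟨ summand-hit g f r x∈A ⟨
  summand A g f (g * x + r) x  ≤⟨ ≤-sumBelow (summand A g f (g * x + r)) (s≤s (m≤n*m+o x r g>0)) ⟩
  convolve A g f (g * x + r)   ∎
  where open ≤-Reasoning

convolve-pos : ∀ {A g f n} → 0 < convolve A g f n → ∃[ x ] ∃[ r ] (x ∈ A × n ≡ g * x + r × 0 < f r)
convolve-pos {A} {g} {f} {n} pos with sumBelow-pos (suc n) (summand A g f n) pos
... | x , _ , summand>0 = x , summand-pos summand>0

convolve-mono : ∀ {A B g f h n} → A ⊆ B → (∀ r → f r ≤ h r) → convolve A g f n ≤ convolve B g h n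
convolve-mono {A} {B} {g} {f} {h} {n} A⊆B f≤h =
  sumBelow-mono-≤ (suc n) (summand A g f n) (summand B g h n) (λ _ → summand-mono A⊆B f≤h)

convolve-mono-< : ∀ {A B g f h x} r → 0 < g → A ⊆ B → (∀ s → f s ≤ h s) → x ∉ A → x ∈ B → 0 < h r →
                  convolve A g f (g * x + r) < convolve B g h (g * x + r)
convolve-mono-< {A} {B} {g} {f} {h} {x} r g>0 A⊆B f≤h x∉A x∈B hr>0 =
  sumBelow-mono-< (summand A g f (g * x + r)) (summand B g h (g * x + r))
    (s≤s (m≤n*m+o x r g>0)) summand<summand (λ _ → summand-mono A⊆B f≤h)
  where
  summand<summand : summand A g f (g * x + r) x < summand B g h (g * x + r) x
  summand<summand = subst₂ _<_ (sym (summand-absent x∉A)) (sym (summand-hit g h r x∈B)) hr>0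

convolve-cancel : ∀ {A g m} {f h : ℕ → ℕ} → 0 < g → IsLeast A m →
                  convolve A g f ≗ convolve A g h → f ≗ h
convolve-cancel {A} {g} {m} {f} {h} g>0 (m∈A , m≤) conv≡ = <-rec (λ n → f n ≡ h n) step
  where
  step : ∀ n → (∀ {j} → j < n → f j ≡ h j) → f n ≡ h n
  step n ih = begin
    f n                          ≡⟨ summand-hit g f n m∈A ⟨
    summand A g f (g * m + n) m  ≡⟨ sumBelow-cancel (summand A g f (g * m + n)) (summand A g h (g * m + n))
                                      (s≤s (m≤n*m+o m n g>0)) others (conv≡ (g * m + n)) ⟩
    summand A g h (g * m + n) m  ≡⟨ summand-hit g h n m∈A ⟩
    h n                          ∎
    where
    open ≡-Reasoning
    -- a summand at y ≠ m only sees values below n, since g * m < g * y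
    others : ∀ {y} → y < suc (g * m + n) → y ≢ m →
             summand A g f (g * m + n) y ≡ summand A g h (g * m + n) y
    others {y} _ y≢m = summand-cong λ {r} y∈A gm+n≡gy+r →
      ih (+-cancelˡ-< (g * m) r n (subst (g * m + r <_) (sym gm+n≡gy+r) (+-monoˡ-< r (gm<gy y∈A))))
      where
      gm<gy : y ∈ A → g * m < g * y
      gm<gy y∈A = *-monoʳ-< g {{>-nonZero g>0}} (≤∧≢⇒< (m≤ y∈A) (y≢m ∘ sym))

reps : NatSet → List ℕ → ℕ → ℕ
reps A []      n = if 0 ≡ᵇ n then 1 else 0
reps A (g ∷ γ) n = convolve A g (reps A γ) n

isRep : NatSet → List ℕ → ℕ → List ℕ → ℕ
isRep A γ n xs = if all A xs ∧ (weighted γ xs ≡ᵇ n) then 1 else 0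

countBounded : NatSet → List ℕ → ℕ → ℕ → ℕ
countBounded A γ b n = sum (map (isRep A γ n) (tuples (length γ) b))

+-≡ᵇ : ∀ k w n → (k + w ≡ᵇ n) ≡ (k ≤ᵇ n) ∧ (w ≡ᵇ n ∸ k)
+-≡ᵇ zero          w n       = refl
+-≡ᵇ (suc k)       w zero    = refl
+-≡ᵇ (suc zero)    w (suc n) = refl
+-≡ᵇ (suc (suc k)) w (suc n) = +-≡ᵇ (suc k) w n

opaque
  unfolding summand

  isRep-∷ : ∀ A g γ n x xs → isRep A (g ∷ γ) n (x ∷ xs) ≡ summand A g (λ r → isRep A γ r xs) n x
  isRep-∷ A g γ n x xs rewrite +-≡ᵇ (g * x) (weighted γ xs) n with A x | g * x ≤ᵇ n
  ... | false | _     = refl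
  ... | true  | true  = refl
  ... | true  | false rewrite ∧-zeroʳ (all A xs) = refl

  sum-map-summand : ∀ {X : Set} {A g n x} (F : X → ℕ → ℕ) ys →
                    sum (map (λ y → summand A g (F y) n x) ys) ≡
                    summand A g (λ r → sum (map (λ y → F y r) ys)) n x
  sum-map-summand {X} {A} {g} {n} {x} F ys with A x ∧ (g * x ≤ᵇ n)
  ... | true  = refl
  ... | false = sum-zeros ys
    where
    sum-zeros : (ys : List X) → sum (map (λ _ → 0) ys) ≡ 0
    sum-zeros []       = refl
    sum-zeros (_ ∷ ys) = sum-zeros ys

sum-concatMap : ∀ {X Y : Set} (f : Y → ℕ) (h : X → List Y) xs →
                sum (map f (concatMap h xs)) ≡ sum (map (sum ∘ map f ∘ h) xs)
sum-concatMap f h []       = refl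
sum-concatMap f h (x ∷ xs) = begin
  sum (map f (h x ++ concatMap h xs))               ≡⟨ cong sum (map-++ f (h x) (concatMap h xs)) ⟩
  sum (map f (h x) ++ map f (concatMap h xs))       ≡⟨ sum-++ (map f (h x)) (map f (concatMap h xs)) ⟩
  sum (map f (h x)) + sum (map f (concatMap h xs))  ≡⟨ cong (sum (map f (h x)) +_) (sum-concatMap f h xs) ⟩
  sum (map f (h x)) + sum (map (sum ∘ map f ∘ h) xs) ∎
  where open ≡-Reasoning

countBounded-∷ : ∀ A g γ b n →
                 countBounded A (g ∷ γ) b n ≡ sumBelow (suc b) (summand A g (countBounded A γ b) n)
countBounded-∷ A g γ b n = begin
  sum (map (isRep A (g ∷ γ) n) (concatMap (λ x → map (x ∷_) T) (upTo (suc b))))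
    ≡⟨ sum-concatMap (isRep A (g ∷ γ) n) (λ x → map (x ∷_) T) (upTo (suc b)) ⟩
  sum (map (λ x → sum (map (isRep A (g ∷ γ) n) (map (x ∷_) T))) (upTo (suc b)))
    ≡⟨ sum-map-applyUpTo (λ x → sum (map (isRep A (g ∷ γ) n) (map (x ∷_) T))) id (suc b) ⟩
  sumBelow (suc b) (λ x → sum (map (isRep A (g ∷ γ) n) (map (x ∷_) T)))
    ≡⟨ sumBelow-cong (suc b) _ _ (λ {x} _ → tuples-from x) ⟩
  sumBelow (suc b) (summand A g (countBounded A γ b) n) ∎
  where
  open ≡-Reasoning
  T = tuples (length γ) b
  tuples-from : ∀ x → sum (map (isRep A (g ∷ γ) n) (map (x ∷_) T)) ≡
                      summand A g (countBounded A γ b) n x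
  tuples-from x = begin
    sum (map (isRep A (g ∷ γ) n) (map (x ∷_) T))              ≡⟨ cong sum (map-∘ T) ⟨
    sum (map (isRep A (g ∷ γ) n ∘ (x ∷_)) T)                  ≡⟨ cong sum (map-cong (isRep-∷ A g γ n x) T) ⟩
    sum (map (λ xs → summand A g (λ r → isRep A γ r xs) n x) T) ≡⟨ sum-map-summand (λ xs r → isRep A γ r xs) T ⟩
    summand A g (countBounded A γ b) n x                      ∎

countBounded≡reps : ∀ {A γ b n} → All (0 <_) γ → n ≤ b → countBounded A γ b n ≡ reps A γ n
countBounded≡reps {γ = []} _ _ = +-identityʳ _
countBounded≡reps {A} {g ∷ γ} {b} {n} (g>0 ∷ γ>0) n≤b = begin
  countBounded A (g ∷ γ) b n                             ≡⟨ countBounded-∷ A g γ b n ⟩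
  sumBelow (suc b) (summand A g (countBounded A γ b) n)  ≡⟨ sumBelow-extend _ (s≤s n≤b) beyond ⟩
  sumBelow (suc n) (summand A g (countBounded A γ b) n)  ≡⟨ sumBelow-cong (suc n) _ (summand A g (reps A γ) n)
                                                              (λ _ → summand-cong by-induction) ⟩
  convolve A g (reps A γ) n                              ∎
  where
  open ≡-Reasoning
  beyond : ∀ {x} → suc n ≤ x → summand A g (countBounded A γ b) n x ≡ 0
  beyond {x} n<x = summand-over (<-≤-trans n<x (m≤n*m x g {{>-nonZero g>0}}))
  by-induction : ∀ {x r} → x ∈ A → n ≡ g * x + r → countBounded A γ b r ≡ reps A γ r
  by-induction {x} {r} _ n≡ =
    countBounded≡reps γ>0 (≤-trans (subst (r ≤_) (sym n≡) (m≤n+m r (g * x))) n≤b)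

R≡reps : ∀ {A γ} n → All (0 <_) γ → R A γ n ≡ reps A γ n
R≡reps n γ>0 = countBounded≡reps γ>0 (≤-refl {n})

SumsetEq⇔reps≗ : ∀ {A B α β} → All (0 <_) α → All (0 <_) β → SumsetEq α A β B ⇔ reps A α ≗ reps B β
SumsetEq⇔reps≗ α>0 β>0 = mk⇔
  (λ eq n → trans (sym (R≡reps n α>0)) (trans (eq n) (R≡reps n β>0)))
  (λ eq n → trans (R≡reps n α>0) (trans (eq n) (sym (R≡reps n β>0))))

reps-mono : ∀ {A B} → A ⊆ B → ∀ γ n → reps A γ n ≤ reps B γ n
reps-mono A⊆B []      n = ≤-refl
reps-mono A⊆B (g ∷ γ) n = convolve-mono A⊆B (reps-mono A⊆B γ)

reps-cong : ∀ {A B} γ → SetEq A B → reps A γ ≗ reps B γ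
reps-cong γ A≡B n = ≤-antisym (reps-mono (λ {x} → trans (sym (A≡B x))) γ n)
                              (reps-mono (λ {x} → trans (A≡B x)) γ n)

reps-[] : ∀ {A} n → 0 < reps A [] n → n ≡ 0
reps-[] zero _ = refl

*-sum-∷ : ∀ m g γ → m * sum (g ∷ γ) ≡ g * m + m * sum γ
*-sum-∷ m g γ = trans (*-distribˡ-+ m g (sum γ)) (cong (_+ m * sum γ) (*-comm m g))

reps-least : ∀ {A m} → m ∈ A → ∀ {γ} → All (0 <_) γ → 0 < reps A γ (m * sum γ)
reps-least {m = m} m∈A {[]} [] rewrite *-zeroʳ m = z<s
reps-least {A} {m} m∈A {g ∷ γ} (g>0 ∷ γ>0) = begin-strict
  0                                   <⟨ reps-least m∈A γ>0 ⟩
  reps A γ (m * sum γ)                ≤⟨ convolve-hit (reps A γ) (m * sum γ) g>0 m∈A ⟩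
  reps A (g ∷ γ) (g * m + m * sum γ)  ≡⟨ cong (reps A (g ∷ γ)) (*-sum-∷ m g γ) ⟨
  reps A (g ∷ γ) (m * sum (g ∷ γ))    ∎
  where open ≤-Reasoning

reps-lowerBound : ∀ {A m} → LowerBound A m → ∀ γ {n} → 0 < reps A γ n → m * sum γ ≤ n
reps-lowerBound {m = m} _ [] _ = ≤-trans (≤-reflexive (*-zeroʳ m)) z≤n
reps-lowerBound {A} {m} m≤ (g ∷ γ) pos with convolve-pos pos
... | x , r , x∈A , refl , r-pos = begin
  m * sum (g ∷ γ)    ≡⟨ *-sum-∷ m g γ ⟩
  g * m + m * sum γ  ≤⟨ +-mono-≤ (*-monoʳ-≤ g (m≤ x∈A)) (reps-lowerBound m≤ γ r-pos) ⟩
  g * x + r          ∎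
  where open ≤-Reasoning

reps-beyond : ∀ {A m c d g γ x r} → LowerBound A m → c ≤ g → m + d ≤ x → 0 < reps A γ r →
              m * sum (g ∷ γ) + c * d ≤ g * x + r
reps-beyond {m = m} {c} {d} {g} {γ} {x} {r} m≤ c≤g m+d≤x r-pos = begin
  m * sum (g ∷ γ) + c * d    ≡⟨ cong (_+ c * d) (*-sum-∷ m g γ) ⟩
  g * m + m * sum γ + c * d  ≤⟨ +-monoʳ-≤ (g * m + m * sum γ) (*-monoˡ-≤ d c≤g) ⟩
  g * m + m * sum γ + g * d  ≡⟨ regroup g m d (m * sum γ) ⟩
  g * (m + d) + m * sum γ    ≤⟨ +-mono-≤ (*-monoʳ-≤ g m+d≤x) (reps-lowerBound m≤ γ r-pos) ⟩
  g * x + r                  ∎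
  where
  open ≤-Reasoning
  regroup : ∀ g m d s → g * m + s + g * d ≡ g * (m + d) + s
  regroup = solve-∀

reps-gap : ∀ {A m d c} → HasGap A m d → ∀ {γ n} → All (c ≤_) γ → 0 < reps A γ n →
           n ≡ m * sum γ ⊎ m * sum γ + c * d ≤ n
reps-gap {A} {m} gap {[]} {n} _ pos = inj₁ (trans (reps-[] {A} n pos) (sym (*-zeroʳ m)))
reps-gap {A} {m} {d} {c} gap {g ∷ γ} (c≤g ∷ c≤γ) pos with convolve-pos pos
... | x , r , x∈A , refl , r-pos with gap x∈A
... | inj₂ m+d≤x = inj₂ (reps-beyond {γ = γ} (HasGap⇒LowerBound gap) c≤g m+d≤x r-pos)
... | inj₁ refl with reps-gap gap c≤γ r-pos
... | inj₁ refl = inj₁ (sym (*-sum-∷ m g γ))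
... | inj₂ r≥   = inj₂ (begin
  m * sum (g ∷ γ) + c * d      ≡⟨ cong (_+ c * d) (*-sum-∷ m g γ) ⟩
  g * m + m * sum γ + c * d    ≡⟨ +-assoc (g * m) (m * sum γ) (c * d) ⟩
  g * m + (m * sum γ + c * d)  ≤⟨ +-monoʳ-≤ (g * m) r≥ ⟩
  g * m + r                    ∎)
  where open ≤-Reasoning

reps-truncate : ∀ {X m c e} → LowerBound X m → ∀ {γ n} → All (c ≤_) γ → n < m * sum γ + c * e →
                reps X γ n ≡ reps (X ∩< (m + e)) γ n
reps-truncate _ {[]} _ _ = refl
reps-truncate {X} {m} {c} {e} m≤ {g ∷ γ} {n} (c≤g ∷ c≤γ) n<bound =
  sumBelow-cong (suc n) (summand X g (reps X γ) n) (summand X′ g (reps X′ γ) n)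
                (λ {x} _ → truncated x)
  where
  X′ = X ∩< (m + e)
  open ≤-Reasoning

  by-induction : ∀ {x r} → x ∈ X → n ≡ g * x + r → reps X γ r ≡ reps X′ γ r
  by-induction {x} {r} x∈X n≡ = reps-truncate m≤ c≤γ (+-cancelˡ-< (g * m) r _ (begin-strict
    g * m + r                    ≤⟨ +-monoˡ-≤ r (*-monoʳ-≤ g (m≤ x∈X)) ⟩
    g * x + r                    ≡⟨ n≡ ⟨
    n                            <⟨ n<bound ⟩
    m * sum (g ∷ γ) + c * e      ≡⟨ cong (_+ c * e) (*-sum-∷ m g γ) ⟩
    g * m + m * sum γ + c * e    ≡⟨ +-assoc (g * m) (m * sum γ) (c * e) ⟩
    g * m + (m * sum γ + c * e)  ∎))

  unrepresentable : ∀ {x r} → m + e ≤ x → x ∈ X → n ≡ g * x + r → reps X γ r ≡ 0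
  unrepresentable {x} {r} m+e≤x _ n≡ = n≤0⇒n≡0 (≮⇒≥ λ r-pos → <⇒≱ n<bound (begin
    m * sum (g ∷ γ) + c * e  ≤⟨ reps-beyond {γ = γ} m≤ c≤g m+e≤x r-pos ⟩
    g * x + r                ≡⟨ n≡ ⟨
    n                        ∎))

  truncated : ∀ x → summand X g (reps X γ) n x ≡ summand X′ g (reps X′ γ) n x
  truncated x with x <? m + e
  ... | yes x<m+e = trans (summand-cong by-induction) (summand-congˡ (sym (∩<-below {X} x<m+e)))
  ... | no x≮m+e  = trans (summand-vanish (unrepresentable (≮⇒≥ x≮m+e)))
                          (sym (summand-absent (∩<-above {X} x≮m+e)))

reps-firstDifference : ∀ {A B a α m k} → 0 < a → All (0 <_) α → All (a ≤_) α → IsLeast A m →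
                       (∀ {j} → j < k → A j ≡ B j) → k ∈ A → k ∉ B →
                       reps B (a ∷ α) (a * k + m * sum α) < reps A (a ∷ α) (a * k + m * sum α)
reps-firstDifference {A} {B} {a} {α} {m} a>0 α>0 a≤α (m∈A , m≤) agree k∈A k∉B
  with m≤n⇒∃[o]m+o≡n (m≤ k∈A)
... | e , refl = begin-strict
  reps B (a ∷ α) N  ≡⟨ reps-truncate lowerBound (≤-refl ∷ a≤α) N<bound ⟩
  reps B′ (a ∷ α) N <⟨ convolve-mono-< (m * sum α) a>0 B′⊆A (reps-mono B′⊆A α)
                         (∉-∩< {B} {m + suc e} k∉B) k∈A (reps-least m∈A α>0) ⟩
  reps A (a ∷ α) N  ∎
  where
  open ≤-Reasoning
  N = a * (m + e) + m * sum α
  B′ = B ∩< (m + suc e)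

  lowerBound : LowerBound B m
  lowerBound {x} x∈B with x <? m + e
  ... | yes x<k = m≤ (trans (agree x<k) x∈B)
  ... | no x≮k  = ≤-trans (m≤m+n m e) (≮⇒≥ x≮k)

  B′⊆A : B′ ⊆ A
  B′⊆A {x} x∈B′ with ∈-∩< {B} x∈B′
  ... | x<k+1 , x∈B with m≤n⇒m<n∨m≡n (s≤s⁻¹ (subst (x <_) (+-suc m e) x<k+1))
  ... | inj₁ x<k  = trans (agree x<k) x∈B
  ... | inj₂ refl = ⊥-elim (∈⇒¬∉ {B} x∈B k∉B)

  N<bound : N < m * sum (a ∷ α) + a * suc e
  N<bound = subst (N <_) (regroup a m e (sum α)) (m<m+n N a>0)
    where
    regroup : ∀ a m e s → a * (m + e) + m * s + a ≡ m * (a + s) + a * (1 + e)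
    regroup = solve-∀

reps-injectiveˡ : ∀ {A B a α} → 0 < a → All (0 <_) α → All (a ≤_) α →
                  reps A (a ∷ α) ≗ reps B (a ∷ α) → SetEq A B
reps-injectiveˡ {A} {B} {a} {α} a>0 α>0 a≤α same = <-rec (λ k → A k ≡ B k) agreeAt
  where
  agreeAt : ∀ k → (∀ {j} → j < k → A j ≡ B j) → A k ≡ B k
  agreeAt k agree with A k in Ak | B k in Bk
  ... | true  | true  = refl
  ... | false | false = refl
  ... | true  | false with least A Ak
  ... | m , A-least = ⊥-elim (<-irrefl (sym (same _))
          (reps-firstDifference a>0 α>0 a≤α A-least agree Ak Bk))
  agreeAt k agree | false | true with least B Bk
  ... | m , B-least = ⊥-elim (<-irrefl (same _)
          (reps-firstDifference a>0 α>0 a≤α B-least (λ j<k → sym (agree j<k)) Bk Ak))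

linked-head≤ : ∀ {b β} → Linked _≤_ (b ∷ β) → All (b ≤_) β
linked-head≤ [-]           = []
linked-head≤ (b≤b′ ∷ b′β) = Linked⇒All ≤-trans b≤b′ b′β

module _ {A : NatSet} {m d : ℕ} (d>0 : 0 < d) (m∈A : m ∈ A) (m+d∈A : m + d ∈ A) (gap : HasGap A m d) where

  private
    m≤ : LowerBound A m
    m≤ = HasGap⇒LowerBound gap

  reps-second : ∀ {g γ} → 0 < g → All (0 <_) γ → 0 < reps A (g ∷ γ) (m * sum (g ∷ γ) + g * d)
  reps-second {g} {γ} g>0 γ>0 = begin-strict
    0                                         <⟨ reps-least m∈A γ>0 ⟩
    reps A γ (m * sum γ)                      ≤⟨ convolve-hit (reps A γ) (m * sum γ) g>0 m+d∈A ⟩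
    reps A (g ∷ γ) (g * (m + d) + m * sum γ)  ≡⟨ cong (reps A (g ∷ γ)) (regroup g m d (sum γ)) ⟩
    reps A (g ∷ γ) (m * sum (g ∷ γ) + g * d)  ∎
    where
    open ≤-Reasoning
    regroup : ∀ g m d s → g * (m + d) + m * s ≡ m * (g + s) + g * d
    regroup = solve-∀

  reps-lowest : ∀ {α β} → All (0 <_) α → All (0 <_) β → reps A α ≗ reps A β → m * sum α ≡ m * sum β
  reps-lowest {α} {β} α>0 β>0 same = ≤-antisym
    (reps-lowerBound m≤ α (subst (0 <_) (sym (same _)) (reps-least m∈A β>0)))
    (reps-lowerBound m≤ β (subst (0 <_) (same _) (reps-least m∈A α>0)))

  -- Compare the second smallest representable numbers, m Σα + a d and m Σβ + b d.
  reps-head≤ : ∀ {a α b β} → All (0 <_) (a ∷ α) → All (0 <_) (b ∷ β) → All (b ≤_) β →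
               reps A (a ∷ α) ≗ reps A (b ∷ β) → b ≤ a
  reps-head≤ {a} {α} {b} {β} a∷α>0@(a>0 ∷ α>0) b∷β>0 b≤β same
    with reps-gap gap (≤-refl ∷ b≤β) (subst (0 <_) (same _) (reps-second a>0 α>0))
  ... | inj₁ eq = ⊥-elim (<-irrefl (sym ad≡0) (*-mono-≤ a>0 d>0))
    where
    ad≡0 : a * d ≡ 0
    ad≡0 = +-cancelˡ-≡ (m * sum (a ∷ α)) (a * d) 0
             (trans eq (trans (sym (reps-lowest a∷α>0 b∷β>0 same)) (sym (+-identityʳ _))))
  ... | inj₂ le = *-cancelʳ-≤ b a d {{>-nonZero d>0}} (+-cancelˡ-≤ (m * sum (a ∷ α)) (b * d) (a * d)
                    (subst (λ s → s + b * d ≤ m * sum (a ∷ α) + a * d)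
                           (sym (reps-lowest a∷α>0 b∷β>0 same)) le))

  reps-[]≉∷ : ∀ {b β} → All (0 <_) (b ∷ β) → ¬ reps A [] ≗ reps A (b ∷ β)
  reps-[]≉∷ {b} {β} (b>0 ∷ β>0) same = <-irrefl (sym n≡0) n>0
    where
    n = m * sum (b ∷ β) + b * d
    n≡0 : n ≡ 0
    n≡0 = reps-[] {A} n (subst (0 <_) (sym (same n)) (reps-second b>0 β>0))
    n>0 : 0 < n
    n>0 = ≤-trans (*-mono-≤ b>0 d>0) (m≤n+m (b * d) _)

  reps-injectiveʳ : ∀ {α β} → All (0 <_) α → Linked _≤_ α → All (0 <_) β → Linked _≤_ β →
                    reps A α ≗ reps A β → α ≡ β
  reps-injectiveʳ {[]}    {[]}    _   _  _   _  _    = refl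
  reps-injectiveʳ {[]}    {_ ∷ _} _   _  β>0 _  same = ⊥-elim (reps-[]≉∷ β>0 same)
  reps-injectiveʳ {_ ∷ _} {[]}    α>0 _  _   _  same = ⊥-elim (reps-[]≉∷ α>0 (sym ∘ same))
  reps-injectiveʳ {a ∷ α} {b ∷ β} a∷α>0@(a>0 ∷ α>0) α↑ b∷β>0@(_ ∷ β>0) β↑ same
    with ≤-antisym (reps-head≤ b∷β>0 a∷α>0 (linked-head≤ α↑) (sym ∘ same))
                   (reps-head≤ a∷α>0 b∷β>0 (linked-head≤ β↑) same)
  ... | refl = cong (a ∷_) (reps-injectiveʳ α>0 (Linked.tail α↑) β>0 (Linked.tail β↑)
                 (convolve-cancel a>0 (m∈A , m≤) same))

corollary1p7 : (A B : NatSet) → AtLeastTwo A → AtLeastTwo B →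
    (α β : List ℕ) → IsZm α → IsZm β →
    (SumsetEq α A α B ⇔ SetEq A B) × (SumsetEq α A β A ⇔ α ≡ β)
corollary1p7 A B _ _ [] β (() , _) _
corollary1p7 A B twoA _ (a ∷ α) β (_ , a∷α>0@(a>0 ∷ α>0) , α↑) (_ , β>0 , β↑)
  with leastTwo twoA
... | m , d , d>0 , m∈A , m+d∈A , gap =
  mk⇔ (reps-injectiveˡ a>0 α>0 (linked-head≤ α↑) ∘ to (SumsetEq⇔reps≗ a∷α>0 a∷α>0))
      (from (SumsetEq⇔reps≗ a∷α>0 a∷α>0) ∘ reps-cong (a ∷ α)) ,
  mk⇔ (reps-injectiveʳ d>0 m∈A m+d∈A gap a∷α>0 α↑ β>0 β↑ ∘ to (SumsetEq⇔reps≗ a∷α>0 β>0))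
      (λ { refl _ → refl })
  where open Equivalence
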